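{- Let $G$ be a connected graph of order $n\geq 4$. Then $\gamma(\overline{C(G)})=2$.
   Context: The central graph $C(G)$ of a simple graph $G$ is obtained from $G$ by subdividing each edge of $G$ exactly once and joining every pair of vertices non-adjacent in $G$ by an edge. $\overline{H}$ denotes the complement of $H$ and $\gamma$ the domination number. -}

module Defs where

open import Data.Nat using (ℕ; _≤_)
open import Data.Fin using (Fin; _<_)
open import Data.Bool using (Bool; true; false)
open import Data.Product using (Σ; _×_; _,_; ∃; proj₁; proj₂)
open import Data.Sum using (_⊎_; inj₁; inj₂)
open import Data.Empty using (⊥)
open import Data.List using (List; length)
open import Data.List.Membership.Propositional using (_∈_)
open import Data.List.Relation.Unary.Unique.Propositional using (Unique)
open import Relation.Binary.PropositionalEquality using (_≡_; _≢_)
open import Relation.Nullary using (¬_)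

record SimpleGraph (n : ℕ) : Set where
  field
    adj     : Fin n → Fin n → Bool
    sym     : ∀ u v → adj u v ≡ adj v u
    irrefl  : ∀ u → adj u u ≡ false
open SimpleGraph public

data Walk {n : ℕ} (G : SimpleGraph n) : Fin n → Fin n → Set where
  here : ∀ {u} → Walk G u u
  step : ∀ {u v w} → adj G u v ≡ true → Walk G v w → Walk G u w

Connected : ∀ {n} → SimpleGraph n → Set
Connected G = ∀ u v → Walk G u v

-- Edges of G, each represented once as an ordered pair (i , j) with i < j.
Edge : ∀ {n} → SimpleGraph n → Set
Edge {n} G = Σ (Fin n × Fin n) λ p → (proj₁ p < proj₂ p) × (adj G (proj₁ p) (proj₂ p) ≡ true)

record Graph : Set₁ where
  field
    V   : Set
    Adj : V → V → Set
open Graph public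

-- Vertices of the central graph C(G): original vertices plus one
-- subdivision vertex per edge.
CVertex : ∀ {n} → SimpleGraph n → Set
CVertex {n} G = Fin n ⊎ Edge G

CAdj : ∀ {n} (G : SimpleGraph n) → CVertex G → CVertex G → Set
CAdj G (inj₁ u) (inj₁ v) = (u ≢ v) × (adj G u v ≡ false)
CAdj G (inj₁ u) (inj₂ e) = (u ≡ proj₁ (proj₁ e)) ⊎ (u ≡ proj₂ (proj₁ e))
CAdj G (inj₂ e) (inj₁ u) = (u ≡ proj₁ (proj₁ e)) ⊎ (u ≡ proj₂ (proj₁ e))
CAdj G (inj₂ e) (inj₂ f) = ⊥

CentralGraph : ∀ {n} → SimpleGraph n → Graph
CentralGraph G = record { V = CVertex G ; Adj = CAdj G }

Complement : Graph → Graph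
Complement H = record { V = V H ; Adj = λ x y → (x ≢ y) × ¬ (Adj H x y) }

-- Dominating set (a duplicate-free list of vertices = a finite vertex set).
Dominating : (H : Graph) → List (V H) → Set
Dominating H D = ∀ v → (v ∈ D) ⊎ (∃ λ u → (u ∈ D) × Adj H u v)

DominationNumber : Graph → ℕ → Set
DominationNumber H k =
  (∃ λ D → Unique D × Dominating H D × length D ≡ k) ×
  (∀ D → Unique D → Dominating H D → k ≤ length D)

{-# OPTIONS --safe #-}
module Submission where

-- For an edge e = ab of G, the pair {a, e} dominates the complement of C(G):
-- the subdivision vertex e is adjacent in C(G) only to a and b, so in the complement it
-- sees every vertex except a and b, and a sees b because ab is not an edge of C(G).
-- Conversely, every vertex of C(G) has a neighbour in C(G) (an original vertex lies on an
-- edge since G is connected with n ≥ 2, a subdivision vertex is adjacent to its ends),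
-- and that neighbour is not dominated by the vertex in the complement; so no single
-- vertex dominates.

open import Defs
open import Data.Nat using (ℕ; _≤_; s≤s; z≤n)
open import Data.Nat.Properties using (<-irrelevant)
open import Data.Fin using (Fin; zero; suc)
open import Data.Fin.Properties using (_≟_; <-cmp)
import Data.Bool as Bool
open import Data.Bool using (true; false)
open import Data.Product using (_×_; _,_; ∃; proj₁; proj₂)
open import Data.Product.Properties using (≡-dec)
open import Data.Sum using (_⊎_; inj₁; inj₂)
open import Data.Empty using (⊥-elim)
open import Data.List using ([]; _∷_; length)
open import Data.List.Relation.Unary.Any using (here; there)
open import Data.List.Relation.Unary.All using ([]; _∷_)
open import Data.List.Relation.Unary.AllPairs using ([]; _∷_)
open import Data.List.Relation.Unary.Unique.Propositional using (Unique)
open import Relation.Binary.Definitions using (DecidableEquality; tri<; tri≈; tri>)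
open import Relation.Binary.PropositionalEquality using (_≡_; _≢_; refl; trans; cong)
import Relation.Binary.PropositionalEquality as ≡
open import Relation.Nullary using (yes; no)
open import Relation.Nullary.Decidable using (map′)
open import Axiom.UniquenessOfIdentityProofs using (module Decidable⇒UIP)

dominating-complement-singleton : (H : Graph) {x y : V H} →
  Dominating (Complement H) (x ∷ []) → Adj H x y → y ≡ x
dominating-complement-singleton H {y = y} dom xy with dom y
... | inj₁ (here y≡x)                  = y≡x
... | inj₂ (_ , here refl , _ , ¬xy)   = ⊥-elim (¬xy xy)

dominating-complement-length : (H : Graph) →
  (∀ x → ∃ λ y → y ≢ x × Adj H x y) → V H →
  ∀ D → Dominating (Complement H) D → 2 ≤ length D
dominating-complement-length H neighbour v [] dom with dom v
... | inj₁ ()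
... | inj₂ (_ , () , _)
dominating-complement-length H neighbour v (x ∷ []) dom =
  let (y , y≢x , xy) = neighbour x
  in  ⊥-elim (y≢x (dominating-complement-singleton H dom xy))
dominating-complement-length H neighbour v (_ ∷ _ ∷ _) dom = s≤s (s≤s z≤n)

module _ {n : ℕ} (G : SimpleGraph n) where

  Incident : Fin n → Edge G → Set
  Incident u e = (u ≡ proj₁ (proj₁ e)) ⊎ (u ≡ proj₂ (proj₁ e))

  Edge-≡ : {e f : Edge G} → proj₁ e ≡ proj₁ f → e ≡ f
  Edge-≡ {_ , i<j , ij} {_ , i<j′ , ij′} refl
    with refl ← <-irrelevant i<j i<j′
       | refl ← Decidable⇒UIP.≡-irrelevant Bool._≟_ ij ij′ = refl

  _≟ₑ_ : DecidableEquality (Edge G)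
  e ≟ₑ f = map′ Edge-≡ (cong proj₁) (≡-dec _≟_ _≟_ (proj₁ e) (proj₁ f))

  edge-incident : ∀ {u w} → adj G u w ≡ true → ∃ (Incident u)
  edge-incident {u} {w} uw with <-cmp u w
  ... | tri< u<w _ _ = ((u , w) , u<w , uw) , inj₁ refl
  ... | tri> _ _ w<u = ((w , u) , w<u , trans (SimpleGraph.sym G w u) uw) , inj₂ refl
  ... | tri≈ _ refl _ with () ← trans (≡.sym uw) (irrefl G u)

  walk-first-neighbour : ∀ {u v} → u ≢ v → Walk G u v → ∃ λ w → adj G u w ≡ true
  walk-first-neighbour u≢v here           = ⊥-elim (u≢v refl)
  walk-first-neighbour u≢v (step uw _)    = _ , uw

  centralGraph-neighbour : (∀ u → ∃ (Incident u)) →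
    ∀ x → ∃ λ y → y ≢ x × CAdj G x y
  centralGraph-neighbour incident (inj₁ u) =
    let (e , u∈e) = incident u in inj₂ e , (λ ()) , u∈e
  centralGraph-neighbour incident (inj₂ e) = inj₁ (proj₁ (proj₁ e)) , (λ ()) , inj₁ refl

  edge-dominates-complement : (e : Edge G) →
    Dominating (Complement (CentralGraph G)) (inj₁ (proj₁ (proj₁ e)) ∷ inj₂ e ∷ [])
  edge-dominates-complement e@((a , b) , _ , ab) (inj₁ w) with w ≟ a | w ≟ b
  ... | yes refl | _     = inj₁ (here refl)
  ... | no w≢a | yes refl =
    inj₂ (inj₁ a , here refl , (λ { refl → w≢a refl }) , λ { (_ , ab≡false) → ab≢false ab≡false })
    where
    ab≢false : adj G a w ≢ false
    ab≢false rewrite ab = λ ()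
  ... | no w≢a | no w≢b =
    inj₂ (inj₂ e , there (here refl) , (λ ()) , λ { (inj₁ w≡a) → w≢a w≡a ; (inj₂ w≡b) → w≢b w≡b })
  edge-dominates-complement e (inj₂ f) with f ≟ₑ e
  ... | yes refl = inj₁ (there (here refl))
  ... | no f≢e   = inj₂ (inj₂ e , there (here refl) , (λ { refl → f≢e refl }) , λ ())

  connected-incident : Connected G → (∀ u → ∃ λ v → u ≢ v) → ∀ u → ∃ (Incident u)
  connected-incident conn other u =
    let (v , u≢v) = other u
    in  edge-incident (proj₂ (walk-first-neighbour u≢v (conn u v)))

other-vertex : ∀ {m} (u : Fin (ℕ.suc (ℕ.suc m))) → ∃ λ v → u ≢ v
other-vertex zero    = suc zero , λ ()
other-vertex (suc u) = zero , λ ()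

theorem4p9 : (n : ℕ) → 4 ≤ n → (G : SimpleGraph n) → Connected G →
    DominationNumber (Complement (CentralGraph G)) 2
theorem4p9 _ (s≤s (s≤s _)) G conn =
  (_ , unique , edge-dominates-complement G e , refl) ,
  λ D _ → dominating-complement-length (CentralGraph G)
            (centralGraph-neighbour G incident) (inj₁ zero) D
  where
  incident : ∀ u → ∃ (Incident G u)
  incident = connected-incident G conn other-vertex
  e : Edge G
  e = proj₁ (incident zero)
  unique : Unique (inj₁ (proj₁ (proj₁ e)) ∷ inj₂ e ∷ [])
  unique = ((λ ()) ∷ []) ∷ [] ∷ []
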